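{- Let $l,k$ be positive integers and let $G_1,\ldots,G_l$ be $k$-symmetric graphs. Let $G=\overline{K}_k\vee_k(G_1\cup\cdots\cup G_l)$. Then $m_G(1)\ge l-1$.
   Context: A finite simple graph $H$ is $k$-symmetric if $\mathrm{Aut}(H)$ contains a subgroup isomorphic to $\mathbb{Z}_k$ acting freely on $V(H)$; a generator $\varphi$ of such a subgroup is a $k$-symmetric automorphism, and a base of $\varphi$ is a subset $B\subseteq V(H)$ containing exactly one vertex from each $\langle\varphi\rangle$-orbit. The graph $G=\overline{K}_k\vee_k(G_1\cup\cdots\cup G_l)$ is defined as follows, for arbitrary choices of $k$-symmetric automorphisms $\varphi_i$ of $G_i$ and bases $B_i$ of $\varphi_i$: take the disjoint union of $G_1,\ldots,G_l$ together with $k$ new pairwise nonadjacent vertices $u_j$, $j\in\mathbb{Z}_k$, and for each $j\in\mathbb{Z}_k$ and each $i\in\{1,\dots,l\}$ join $u_j$ to every vertex of $\varphi_i^j(B_i)$; no other edges are added (in particular no edges between distinct $G_i$). $m_G(\lambda)$ denotes the multiplicity of $\lambda$ as an eigenvalue of the Laplacian $L(G)=D(G)-A(G)$. -}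

module Defs where

open import Data.Nat using (ℕ; zero; suc; _<_; _∸_)
open import Data.Fin using (Fin; toℕ) renaming (_≟_ to _≟F_)
open import Data.Fin.Permutation using (Permutation′; _⟨$⟩ʳ_; _⟨$⟩ˡ_)
open import Data.Bool using (Bool; true; false; if_then_else_)
open import Data.Rational using (ℚ; 0ℚ; 1ℚ; _+_; _*_; _-_)
open import Data.Product using (Σ; Σ-syntax; _×_; _,_)
open import Data.Sum using (_⊎_; inj₁; inj₂)
open import Relation.Nullary using (¬_; yes; no)
open import Relation.Binary.PropositionalEquality using (_≡_; refl)
open import Relation.Binary.Definitions using (DecidableEquality)
import Data.Sum.Properties as SumP
import Data.Product.Properties as ProdP

record Graph : Set where
  field
    n      : ℕ
    adj    : Fin n → Fin n → Bool
    sym    : ∀ u v → adj u v ≡ adj v u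
    irrefl : ∀ v → adj v v ≡ false
open Graph public

iter : {A : Set} → (A → A) → ℕ → A → A
iter f zero    x = x
iter f (suc j) x = f (iter f j x)

-- φ is a k-symmetric automorphism of H: an automorphism generating a
-- subgroup of Aut(H) isomorphic to ℤ_k acting freely on V(H), i.e.
-- φ^k = id and φ^j has no fixed vertex for 0 < j < k.
record KSymAut (k : ℕ) (H : Graph) : Set where
  field
    perm     : Permutation′ (n H)
    preserve : ∀ u v → adj H (perm ⟨$⟩ʳ u) (perm ⟨$⟩ʳ v) ≡ adj H u v
    order    : ∀ v → iter (perm ⟨$⟩ʳ_) k v ≡ v
    free     : ∀ (j : ℕ) v → 0 < j → j < k → ¬ (iter (perm ⟨$⟩ʳ_) j v ≡ v)
open KSymAut public

KSymmetric : ℕ → Graph → Set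
KSymmetric k H = KSymAut k H

-- B ⊆ V(H) (as a Boolean predicate) is a base of φ: it contains exactly
-- one vertex of every ⟨φ⟩-orbit {φ^j v | j ∈ ℤ_k}.
IsBase : {k : ℕ} {H : Graph} → KSymAut k H → (Fin (n H) → Bool) → Set
IsBase {k} {H} φ B =
  ∀ v → Σ[ j ∈ Fin k ] (B (iter (perm φ ⟨$⟩ʳ_) (toℕ j) v) ≡ true
        × (∀ (j′ : Fin k) → B (iter (perm φ ⟨$⟩ʳ_) (toℕ j′) v) ≡ true → j′ ≡ j))

module Join (k l : ℕ) (G : Fin l → Graph)
            (φ : (i : Fin l) → KSymAut k (G i))
            (B : (i : Fin l) → Fin (n (G i)) → Bool) where

  V : Set
  V = Fin k ⊎ Σ[ i ∈ Fin l ] Fin (n (G i))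

  _≟V_ : DecidableEquality V
  _≟V_ = SumP.≡-dec _≟F_ (ProdP.≡-dec _≟F_ _≟F_)

  -- x ∈ φ_i^j (B_i)  iff  φ_i^{-j}(x) ∈ B_i
  inShift : (i : Fin l) → Fin k → Fin (n (G i)) → Bool
  inShift i j x = B i (iter (perm (φ i) ⟨$⟩ˡ_) (toℕ j) x)

  adjG : V → V → Bool
  adjG (inj₁ _) (inj₁ _) = false
  adjG (inj₁ j) (inj₂ (i , x)) = inShift i j x
  adjG (inj₂ (i , x)) (inj₁ j) = inShift i j x
  adjG (inj₂ (i , x)) (inj₂ (i′ , y)) with i ≟F i′
  ... | yes refl = adj (G i) x y
  ... | no _     = false

sumFin : (m : ℕ) → (Fin m → ℚ) → ℚ
sumFin zero    f = 0ℚ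
sumFin (suc m) f = f Fin.zero + sumFin m (λ i → f (Fin.suc i))

module JoinLA (k l : ℕ) (G : Fin l → Graph)
              (φ : (i : Fin l) → KSymAut k (G i))
              (B : (i : Fin l) → Fin (n (G i)) → Bool) where
  open Join k l G φ B public

  sumV : (V → ℚ) → ℚ
  sumV f = sumFin k (λ j → f (inj₁ j))
         + sumFin l (λ i → sumFin (n (G i)) (λ x → f (inj₂ (i , x))))

  A : V → V → ℚ
  A v w = if adjG v w then 1ℚ else 0ℚ

  deg : V → ℚ
  deg v = sumV (A v)

  L : V → V → ℚ
  L v w with v ≟V w
  ... | yes _ = deg v - A v w
  ... | no _  = 0ℚ - A v w

  Lx : (V → ℚ) → V → ℚ
  Lx x v = sumV (λ w → L v w * x w)

  -- x is a (possibly zero) solution of L x = λ x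
  InEigenspace : ℚ → (V → ℚ) → Set
  InEigenspace λ′ x = ∀ v → Lx x v ≡ λ′ * x v

  LinIndep : (m : ℕ) → (Fin m → V → ℚ) → Set
  LinIndep m e = ∀ (c : Fin m → ℚ) →
                 (∀ v → sumFin m (λ t → c t * e t v) ≡ 0ℚ) → ∀ t → c t ≡ 0ℚ

  -- m_G(λ) ≥ m : the λ-eigenspace of the (symmetric) Laplacian has
  -- dimension at least m
  MultAtLeast : ℚ → ℕ → Set
  MultAtLeast λ′ m = Σ[ e ∈ (Fin m → V → ℚ) ]
                       ((∀ t → InEigenspace λ′ (e t)) × LinIndep m e)

module Submission where

-- Write b_i = |B_i|. Since B_i meets every ⟨φ_i⟩-orbit exactly once, every
-- vertex of G_i has exactly one neighbour among the u_j; since φ_i^j is a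
-- bijection, every u_j has exactly b_i neighbours in G_i. Hence for the vector
-- x that is c_i on G_i and 0 on the u_j, L x agrees with x on each G_i and
-- equals -Σ b_i c_i at every u_j. Choosing c_0 = -b_s, c_s = b_0 and all other
-- c_i = 0 (s = 1, …, l-1) gives l-1 eigenvectors for 1; they are independent
-- because b_0 > 0 and only the s-th one is nonzero on G_s.

open import Defs hiding (sym)
open import Data.Nat using (ℕ; zero; suc; _<_; _∸_) renaming (_+_ to _+ℕ_)
open import Data.Nat.Properties using (+-suc; m+[n∸m]≡n)
open import Data.Fin using (Fin; zero; suc; toℕ; opposite; fromℕ<) renaming (_≟_ to _≟F_)
open import Data.Fin.Properties using (opposite-prop; opposite-involutive; toℕ<n; suc-injective)
open import Data.Fin.Permutation using (Permutation′; _⟨$⟩ʳ_; _⟨$⟩ˡ_; flip; inverseˡ)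
open import Data.Bool using (Bool; true; false; if_then_else_)
open import Data.Rational using (ℚ; 0ℚ; 1ℚ; _+_; _*_; _-_; -_; Positive; NonNegative; NonZero; 1/_)
open import Data.Rational.Properties
  using ( +-0-commutativeMonoid; +-identityˡ; +-identityʳ; *-identityˡ; *-identityʳ; *-zeroˡ; *-zeroʳ
        ; *-inverseʳ; pos+nonNeg⇒pos; nonNeg+pos⇒pos; nonNeg+nonNeg⇒nonNeg; pos⇒nonZero )
open import Data.Rational.Solver using (module +-*-Solver)
open import Data.Product using (_,_)
open import Data.Sum using (inj₁; inj₂)
open import Data.Empty using (⊥-elim)
open import Function using (_∘_)
open import Relation.Nullary using (¬_; yes; no)
open import Relation.Binary.PropositionalEquality using (_≡_; refl; sym; trans; cong; cong₂; module ≡-Reasoning)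
import Algebra.Properties.CommutativeMonoid.Sum as CommutativeMonoidSum
open ≡-Reasoning
open +-*-Solver

sumFin-cong : ∀ m {f g : Fin m → ℚ} → (∀ i → f i ≡ g i) → sumFin m f ≡ sumFin m g
sumFin-cong zero    f≗g = refl
sumFin-cong (suc m) f≗g = cong₂ _+_ (f≗g zero) (sumFin-cong m (λ i → f≗g (suc i)))

sumFin-zero : ∀ m (f : Fin m → ℚ) → (∀ i → f i ≡ 0ℚ) → sumFin m f ≡ 0ℚ
sumFin-zero zero    f f≗0 = refl
sumFin-zero (suc m) f f≗0 =
  cong₂ _+_ (f≗0 zero) (sumFin-zero m (λ i → f (suc i)) (λ i → f≗0 (suc i)))

sumFin-single : ∀ m (f : Fin m → ℚ) i → (∀ j → ¬ j ≡ i → f j ≡ 0ℚ) → sumFin m f ≡ f i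
sumFin-single (suc m) f zero others = begin
  f zero + sumFin m (λ j → f (suc j))
    ≡⟨ cong (f zero +_) (sumFin-zero m _ (λ j → others (suc j) (λ ()))) ⟩
  f zero + 0ℚ
    ≡⟨ +-identityʳ _ ⟩
  f zero ∎
sumFin-single (suc m) f (suc i) others = begin
  f zero + sumFin m (λ j → f (suc j))
    ≡⟨ cong₂ _+_ (others zero (λ ()))
                 (sumFin-single m _ i (λ j j≢i → others (suc j) (λ eq → j≢i (suc-injective eq)))) ⟩
  0ℚ + f (suc i)
    ≡⟨ +-identityˡ _ ⟩
  f (suc i) ∎

sumFin-distribʳ : ∀ m (f : Fin m → ℚ) c → sumFin m (λ i → f i * c) ≡ sumFin m f * c
sumFin-distribʳ zero    f c = sym (*-zeroˡ c)
sumFin-distribʳ (suc m) f c = begin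
  f zero * c + sumFin m (λ i → f (suc i) * c)
    ≡⟨ cong (f zero * c +_) (sumFin-distribʳ m (λ i → f (suc i)) c) ⟩
  f zero * c + sumFin m (λ i → f (suc i)) * c
    ≡⟨ solve 3 (λ a s c → a :* c :+ s :* c := (a :+ s) :* c) refl (f zero) _ c ⟩
  (f zero + sumFin m (λ i → f (suc i))) * c ∎

sumFin-distrib-- : ∀ m (f g : Fin m → ℚ) → sumFin m (λ i → f i - g i) ≡ sumFin m f - sumFin m g
sumFin-distrib-- zero    f g = refl
sumFin-distrib-- (suc m) f g = begin
  (f zero - g zero) + sumFin m (λ i → f (suc i) - g (suc i))
    ≡⟨ cong ((f zero - g zero) +_) (sumFin-distrib-- m (λ i → f (suc i)) (λ i → g (suc i))) ⟩
  (f zero - g zero) + (Σf - Σg)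
    ≡⟨ solve 4 (λ a b s t → (a :- b) :+ (s :- t) := (a :+ s) :- (b :+ t)) refl (f zero) (g zero) Σf Σg ⟩
  (f zero + Σf) - (g zero + Σg) ∎
  where
  Σf = sumFin m (λ i → f (suc i))
  Σg = sumFin m (λ i → g (suc i))

module ℚ-Sum = CommutativeMonoidSum +-0-commutativeMonoid

sumFin≡sum : ∀ m (f : Fin m → ℚ) → sumFin m f ≡ ℚ-Sum.sum f
sumFin≡sum zero    f = refl
sumFin≡sum (suc m) f = cong (f zero +_) (sumFin≡sum m (λ i → f (suc i)))

sumFin-permute : ∀ m (π : Permutation′ m) (f : Fin m → ℚ) → sumFin m (λ i → f (π ⟨$⟩ˡ i)) ≡ sumFin m f
sumFin-permute m π f = begin
  sumFin m (λ i → f (π ⟨$⟩ˡ i)) ≡⟨ sumFin≡sum m _ ⟩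
  ℚ-Sum.sum (λ i → f (π ⟨$⟩ˡ i)) ≡⟨ sym (ℚ-Sum.sum-permute f (flip π)) ⟩
  ℚ-Sum.sum f                    ≡⟨ sym (sumFin≡sum m f) ⟩
  sumFin m f ∎

sumFin-permute-iter : ∀ m (π : Permutation′ m) a (f : Fin m → ℚ) →
                      sumFin m (λ i → f (iter (π ⟨$⟩ˡ_) a i)) ≡ sumFin m f
sumFin-permute-iter m π zero    f = refl
sumFin-permute-iter m π (suc a) f =
  trans (sumFin-permute-iter m π a (λ i → f (π ⟨$⟩ˡ i))) (sumFin-permute m π f)

indicator : Bool → ℚ
indicator b = if b then 1ℚ else 0ℚ

sumFin-indicator-unique : ∀ m (p : Fin m → Bool) i → p i ≡ true → (∀ j → p j ≡ true → j ≡ i) →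
                          sumFin m (λ j → indicator (p j)) ≡ 1ℚ
sumFin-indicator-unique m p i pi unique = trans (sumFin-single m _ i others) (cong indicator pi)
  where
  others : ∀ j → ¬ j ≡ i → indicator (p j) ≡ 0ℚ
  others j j≢i with p j in pj
  ... | true  = ⊥-elim (j≢i (unique j pj))
  ... | false = refl

indicator-nonNegative : ∀ b → NonNegative (indicator b)
indicator-nonNegative true  = _
indicator-nonNegative false = _

sumFin-indicator-nonNegative : ∀ m (p : Fin m → Bool) → NonNegative (sumFin m (λ j → indicator (p j)))
sumFin-indicator-nonNegative zero    p = _
sumFin-indicator-nonNegative (suc m) p =
  nonNeg+nonNeg⇒nonNeg (indicator (p zero)) {{indicator-nonNegative (p zero)}}
                       (sumFin m (λ j → indicator (p (suc j))))
                       {{sumFin-indicator-nonNegative m (λ j → p (suc j))}}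

sumFin-indicator-positive : ∀ m (p : Fin m → Bool) i → p i ≡ true →
                            Positive (sumFin m (λ j → indicator (p j)))
sumFin-indicator-positive (suc m) p zero pi rewrite pi =
  pos+nonNeg⇒pos 1ℚ (sumFin m (λ j → indicator (p (suc j))))
                 {{sumFin-indicator-nonNegative m (λ j → p (suc j))}}
sumFin-indicator-positive (suc m) p (suc i) pi =
  nonNeg+pos⇒pos (indicator (p zero)) {{indicator-nonNegative (p zero)}}
                 (sumFin m (λ j → indicator (p (suc j))))
                 {{sumFin-indicator-positive m (λ j → p (suc j)) i pi}}

*-cancelʳ-0 : ∀ x y .{{_ : NonZero y}} → x * y ≡ 0ℚ → x ≡ 0ℚ
*-cancelʳ-0 x y xy≡0 = begin
  x                  ≡⟨ sym (*-identityʳ x) ⟩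
  x * 1ℚ             ≡⟨ cong (x *_) (sym (*-inverseʳ y)) ⟩
  x * (y * (1/ y))   ≡⟨ solve 3 (λ x y z → x :* (y :* z) := (x :* y) :* z) refl x y (1/ y) ⟩
  (x * y) * (1/ y)   ≡⟨ cong (_* (1/ y)) xy≡0 ⟩
  0ℚ * (1/ y)        ≡⟨ *-zeroˡ (1/ y) ⟩
  0ℚ ∎

iter-+ : {A : Set} (f : A → A) → ∀ a b x → iter f (a +ℕ b) x ≡ iter f a (iter f b x)
iter-+ f zero    b x = refl
iter-+ f (suc a) b x = cong f (iter-+ f a b x)

iter-suc-inner : {A : Set} (f : A → A) → ∀ a x → iter f (suc a) x ≡ iter f a (f x)
iter-suc-inner f zero    x = refl
iter-suc-inner f (suc a) x = cong f (iter-suc-inner f a x)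

module _ {m : ℕ} (π : Permutation′ m) where

  iter⁻¹-iter : ∀ a x → iter (π ⟨$⟩ˡ_) a (iter (π ⟨$⟩ʳ_) a x) ≡ x
  iter⁻¹-iter zero    x = refl
  iter⁻¹-iter (suc a) x = begin
    iter (π ⟨$⟩ˡ_) (suc a) (π ⟨$⟩ʳ iter (π ⟨$⟩ʳ_) a x)    ≡⟨ iter-suc-inner (π ⟨$⟩ˡ_) a _ ⟩
    iter (π ⟨$⟩ˡ_) a (π ⟨$⟩ˡ (π ⟨$⟩ʳ iter (π ⟨$⟩ʳ_) a x))  ≡⟨ cong (iter (π ⟨$⟩ˡ_) a) (inverseˡ π) ⟩
    iter (π ⟨$⟩ˡ_) a (iter (π ⟨$⟩ʳ_) a x)                  ≡⟨ iter⁻¹-iter a x ⟩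
    x ∎

  iter⁻¹≡iter-complement : ∀ K → (∀ x → iter (π ⟨$⟩ʳ_) K x ≡ x) →
                           ∀ a b → a +ℕ b ≡ K → ∀ x → iter (π ⟨$⟩ˡ_) a x ≡ iter (π ⟨$⟩ʳ_) b x
  iter⁻¹≡iter-complement K order a b a+b≡K x = begin
    iter (π ⟨$⟩ˡ_) a x
      ≡⟨ cong (iter (π ⟨$⟩ˡ_) a) (sym (order x)) ⟩
    iter (π ⟨$⟩ˡ_) a (iter (π ⟨$⟩ʳ_) K x)
      ≡⟨ cong (λ c → iter (π ⟨$⟩ˡ_) a (iter (π ⟨$⟩ʳ_) c x)) (sym a+b≡K) ⟩
    iter (π ⟨$⟩ˡ_) a (iter (π ⟨$⟩ʳ_) (a +ℕ b) x)
      ≡⟨ cong (iter (π ⟨$⟩ˡ_) a) (iter-+ (π ⟨$⟩ʳ_) a b x) ⟩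
    iter (π ⟨$⟩ˡ_) a (iter (π ⟨$⟩ʳ_) a (iter (π ⟨$⟩ʳ_) b x))
      ≡⟨ iter⁻¹-iter a _ ⟩
    iter (π ⟨$⟩ʳ_) b x ∎

negate : ∀ {k′} → Fin (suc k′) → Fin (suc k′)
negate zero    = zero
negate (suc i) = suc (opposite i)

negate-involutive : ∀ {k′} (j : Fin (suc k′)) → negate (negate j) ≡ j
negate-involutive zero    = refl
negate-involutive (suc i) = cong suc (opposite-involutive i)

toℕ-suc+negate : ∀ {k′} (i : Fin k′) → toℕ (suc i) +ℕ toℕ (negate (suc i)) ≡ suc k′
toℕ-suc+negate {k′} i = begin
  suc (toℕ i) +ℕ suc (toℕ (opposite i))      ≡⟨ +-suc (suc (toℕ i)) _ ⟩
  suc (suc (toℕ i) +ℕ toℕ (opposite i))      ≡⟨ cong (λ o → suc (suc (toℕ i) +ℕ o)) (opposite-prop i) ⟩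
  suc (suc (toℕ i) +ℕ (k′ ∸ suc (toℕ i)))    ≡⟨ cong suc (m+[n∸m]≡n (toℕ<n i)) ⟩
  suc k′ ∎

iter⁻¹≡iter-negate : ∀ {m k′} (π : Permutation′ m) → (∀ x → iter (π ⟨$⟩ʳ_) (suc k′) x ≡ x) →
                     ∀ (j : Fin (suc k′)) x →
                     iter (π ⟨$⟩ˡ_) (toℕ j) x ≡ iter (π ⟨$⟩ʳ_) (toℕ (negate j)) x
iter⁻¹≡iter-negate π order zero    x = refl
iter⁻¹≡iter-negate π order (suc i) x = iter⁻¹≡iter-complement π _ order _ _ (toℕ-suc+negate i) x

module JoinLaplacian (k′ l : ℕ) (G : Fin l → Graph)
                     (φ : (i : Fin l) → KSymAut (suc k′) (G i))
                     (B : (i : Fin l) → Fin (n (G i)) → Bool)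
                     (isBase : ∀ i → IsBase (φ i) (B i)) where

  k : ℕ
  k = suc k′

  open JoinLA k l G φ B

  sumV-cong : {f g : V → ℚ} → (∀ v → f v ≡ g v) → sumV f ≡ sumV g
  sumV-cong f≗g = cong₂ _+_ (sumFin-cong k (λ j → f≗g (inj₁ j)))
                            (sumFin-cong l (λ i → sumFin-cong (n (G i)) (λ x → f≗g (inj₂ (i , x)))))

  sumV-distrib-- : (f g : V → ℚ) → sumV (λ v → f v - g v) ≡ sumV f - sumV g
  sumV-distrib-- f g = begin
    sumV (λ v → f v - g v)
      ≡⟨ cong₂ _+_ (sumFin-distrib-- k (λ j → f (inj₁ j)) (λ j → g (inj₁ j)))
                   (trans (sumFin-cong l (λ i → sumFin-distrib-- (n (G i)) (fᵢ i) (gᵢ i)))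
                          (sumFin-distrib-- l (λ i → sumFin (n (G i)) (fᵢ i)) (λ i → sumFin (n (G i)) (gᵢ i)))) ⟩
    (F₁ - G₁) + (F₂ - G₂)
      ≡⟨ solve 4 (λ a b c d → (a :- b) :+ (c :- d) := (a :+ c) :- (b :+ d)) refl F₁ G₁ F₂ G₂ ⟩
    sumV f - sumV g ∎
    where
    fᵢ gᵢ : (i : Fin l) → Fin (n (G i)) → ℚ
    fᵢ i x = f (inj₂ (i , x))
    gᵢ i x = g (inj₂ (i , x))
    F₁ = sumFin k (λ j → f (inj₁ j))
    G₁ = sumFin k (λ j → g (inj₁ j))
    F₂ = sumFin l (λ i → sumFin (n (G i)) (fᵢ i))
    G₂ = sumFin l (λ i → sumFin (n (G i)) (gᵢ i))

  sumV-block : (f : V → ℚ) (i : Fin l) → (∀ i′ x → ¬ i′ ≡ i → f (inj₂ (i′ , x)) ≡ 0ℚ) →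
               sumV f ≡ sumFin k (λ j → f (inj₁ j)) + sumFin (n (G i)) (λ x → f (inj₂ (i , x)))
  sumV-block f i outside =
    cong (sumFin k (λ j → f (inj₁ j)) +_)
         (sumFin-single l _ i (λ i′ i′≢i → sumFin-zero (n (G i′)) _ (λ x → outside i′ x i′≢i)))

  sumV-single : (f : V → ℚ) (v : V) → (∀ w → ¬ w ≡ v → f w ≡ 0ℚ) → sumV f ≡ f v
  sumV-single f (inj₁ j) others = begin
    sumV f
      ≡⟨ cong₂ _+_ (sumFin-single k _ j (λ j′ j′≢j → others (inj₁ j′) (λ { refl → j′≢j refl })))
                   (sumFin-zero l _ (λ i → sumFin-zero (n (G i)) _ (λ x → others (inj₂ (i , x)) (λ ())))) ⟩
    f (inj₁ j) + 0ℚ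
      ≡⟨ +-identityʳ _ ⟩
    f (inj₁ j) ∎
  sumV-single f (inj₂ (i , x)) others = begin
    sumV f
      ≡⟨ sumV-block f i (λ i′ y i′≢i → others (inj₂ (i′ , y)) (λ { refl → i′≢i refl })) ⟩
    sumFin k (λ j → f (inj₁ j)) + sumFin (n (G i)) (λ y → f (inj₂ (i , y)))
      ≡⟨ cong₂ _+_ (sumFin-zero k _ (λ j → others (inj₁ j) (λ ())))
                   (sumFin-single (n (G i)) _ x (λ y y≢x → others (inj₂ (i , y)) (λ { refl → y≢x refl }))) ⟩
    0ℚ + f (inj₂ (i , x))
      ≡⟨ +-identityˡ _ ⟩
    f (inj₂ (i , x)) ∎

  Ax : (V → ℚ) → V → ℚ
  Ax x v = sumV (λ w → A v w * x w)

  Lx≡deg*x-Ax : (x : V → ℚ) (v : V) → Lx x v ≡ deg v * x v - Ax x v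
  Lx≡deg*x-Ax x v = begin
    sumV (λ w → L v w * x w)          ≡⟨ sumV-cong split ⟩
    sumV (λ w → D w - A v w * x w)    ≡⟨ sumV-distrib-- D (λ w → A v w * x w) ⟩
    sumV D - Ax x v                   ≡⟨ cong (_- Ax x v) (sumV-single D v D-off) ⟩
    D v - Ax x v                      ≡⟨ cong (_- Ax x v) D-diag ⟩
    deg v * x v - Ax x v ∎
    where
    D : V → ℚ
    D w with v ≟V w
    ... | yes _ = deg v * x w
    ... | no _  = 0ℚ

    split : ∀ w → L v w * x w ≡ D w - A v w * x w
    split w with v ≟V w
    ... | yes _ = solve 3 (λ d a y → (d :- a) :* y := d :* y :- a :* y) refl (deg v) (A v w) (x w)
    ... | no _  = solve 2 (λ a y → (con 0ℚ :- a) :* y := con 0ℚ :- a :* y) refl (A v w) (x w)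

    D-off : ∀ w → ¬ w ≡ v → D w ≡ 0ℚ
    D-off w w≢v with v ≟V w
    ... | yes v≡w = ⊥-elim (w≢v (sym v≡w))
    ... | no _    = refl

    D-diag : D v ≡ deg v * x v
    D-diag with v ≟V v
    ... | yes _   = refl
    ... | no v≢v  = ⊥-elim (v≢v refl)

  baseSize : Fin l → ℚ
  baseSize i = sumFin (n (G i)) (λ x → indicator (B i x))

  baseSize-positive : ∀ i → 0 < n (G i) → Positive (baseSize i)
  baseSize-positive i nonempty with isBase i (fromℕ< nonempty)
  ... | (_ , inBase , _) = sumFin-indicator-positive (n (G i)) (B i) _ inBase

  neighboursInBlock : ∀ j i → sumFin (n (G i)) (λ x → A (inj₁ j) (inj₂ (i , x))) ≡ baseSize i
  neighboursInBlock j i = sumFin-permute-iter (n (G i)) (perm (φ i)) (toℕ j) (λ x → indicator (B i x))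

  uniqueApexNeighbour : ∀ i x → sumFin k (λ j → A (inj₂ (i , x)) (inj₁ j)) ≡ 1ℚ
  uniqueApexNeighbour i x with isBase i x
  ... | (j₀ , inBase , unique) =
    sumFin-indicator-unique k (λ j → inShift i j x) (negate j₀) shifted shifted-unique
    where
    shift : ∀ j → inShift i j x ≡ B i (iter (perm (φ i) ⟨$⟩ʳ_) (toℕ (negate j)) x)
    shift j = cong (B i) (iter⁻¹≡iter-negate (perm (φ i)) (order (φ i)) j x)

    shifted : inShift i (negate j₀) x ≡ true
    shifted = trans (shift (negate j₀)) (trans (cong (λ j → B i (iter (perm (φ i) ⟨$⟩ʳ_) (toℕ j) x))
                                                     (negate-involutive j₀)) inBase)

    shifted-unique : ∀ j → inShift i j x ≡ true → j ≡ negate j₀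
    shifted-unique j hit = trans (sym (negate-involutive j))
                                 (cong negate (unique (negate j) (trans (sym (shift j)) hit)))

  noEdgeBetweenBlocks : ∀ {i i′} x y → ¬ i′ ≡ i → A (inj₂ (i , x)) (inj₂ (i′ , y)) ≡ 0ℚ
  noEdgeBetweenBlocks {i} {i′} x y i′≢i with i ≟F i′
  ... | yes i≡i′ = ⊥-elim (i′≢i (sym i≡i′))
  ... | no _     = refl

  blockV : (Fin l → ℚ) → V → ℚ
  blockV c (inj₁ _)       = 0ℚ
  blockV c (inj₂ (i , _)) = c i

  Lx-blockV-inj₁ : ∀ c j → Lx (blockV c) (inj₁ j) ≡ - sumFin l (λ i → baseSize i * c i)
  Lx-blockV-inj₁ c j = begin
    Lx (blockV c) (inj₁ j)
      ≡⟨ Lx≡deg*x-Ax (blockV c) (inj₁ j) ⟩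
    deg (inj₁ j) * 0ℚ - Ax (blockV c) (inj₁ j)
      ≡⟨ cong₂ (λ a s → deg (inj₁ j) * 0ℚ - (a + s)) (sumFin-zero k _ (λ _ → refl))
               (sumFin-cong l (λ i → trans (sumFin-distribʳ (n (G i)) _ (c i))
                                           (cong (_* c i) (neighboursInBlock j i)))) ⟩
    deg (inj₁ j) * 0ℚ - (0ℚ + S)
      ≡⟨ solve 2 (λ d s → d :* con 0ℚ :- (con 0ℚ :+ s) := :- s) refl (deg (inj₁ j)) S ⟩
    - S ∎
    where S = sumFin l (λ i → baseSize i * c i)

  Lx-blockV-inj₂ : ∀ c i x → Lx (blockV c) (inj₂ (i , x)) ≡ c i
  Lx-blockV-inj₂ c i x = begin
    Lx (blockV c) v                ≡⟨ Lx≡deg*x-Ax (blockV c) v ⟩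
    deg v * c i - Ax (blockV c) v  ≡⟨ cong₂ (λ δ a → δ * c i - a) deg≡ Ax≡ ⟩
    (1ℚ + d) * c i - (0ℚ + d * c i)
      ≡⟨ solve 2 (λ d c → (con 1ℚ :+ d) :* c :- (con 0ℚ :+ d :* c) := c) refl d (c i) ⟩
    c i ∎
    where
    v = inj₂ (i , x)
    d = sumFin (n (G i)) (λ y → A v (inj₂ (i , y)))

    deg≡ : deg v ≡ 1ℚ + d
    deg≡ = trans (sumV-block (A v) i (λ i′ y → noEdgeBetweenBlocks x y))
                 (cong (_+ d) (uniqueApexNeighbour i x))

    Ax≡ : Ax (blockV c) v ≡ 0ℚ + d * c i
    Ax≡ = trans (sumV-block (λ w → A v w * blockV c w) i
                            (λ i′ y i′≢i → trans (cong (_* c i′) (noEdgeBetweenBlocks x y i′≢i)) (*-zeroˡ (c i′))))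
                (cong₂ _+_ (sumFin-zero k _ (λ j → *-zeroʳ (A v (inj₁ j))))
                           (sumFin-distribʳ (n (G i)) (λ y → A v (inj₂ (i , y))) (c i)))

  blockV-eigenvector : ∀ c → sumFin l (λ i → baseSize i * c i) ≡ 0ℚ → InEigenspace 1ℚ (blockV c)
  blockV-eigenvector c balanced (inj₁ j)       = trans (Lx-blockV-inj₁ c j) (cong -_ balanced)
  blockV-eigenvector c balanced (inj₂ (i , x)) = trans (Lx-blockV-inj₂ c i x) (sym (*-identityˡ (c i)))

module Eigenbasis (l′ k′ : ℕ) (G : Fin (suc l′) → Graph) (nonempty : ∀ i → 0 < n (G i))
                  (φ : (i : Fin (suc l′)) → KSymAut (suc k′) (G i))
                  (B : (i : Fin (suc l′)) → Fin (n (G i)) → Bool)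
                  (isBase : ∀ i → IsBase (φ i) (B i)) where

  open JoinLaplacian k′ (suc l′) G φ B isBase
  open JoinLA (suc k′) (suc l′) G φ B using (V; InEigenspace; LinIndep)

  b₀ : ℚ
  b₀ = baseSize zero

  coeff : Fin l′ → Fin (suc l′) → ℚ
  coeff t zero = - baseSize (suc t)
  coeff t (suc t′) with t′ ≟F t
  ... | yes _ = b₀
  ... | no _  = 0ℚ

  coeff-diag : ∀ t → coeff t (suc t) ≡ b₀
  coeff-diag t with t ≟F t
  ... | yes _   = refl
  ... | no t≢t  = ⊥-elim (t≢t refl)

  coeff-off : ∀ t t′ → ¬ t′ ≡ t → coeff t (suc t′) ≡ 0ℚ
  coeff-off t t′ t′≢t with t′ ≟F t
  ... | yes t′≡t = ⊥-elim (t′≢t t′≡t)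
  ... | no _     = refl

  coeff-balanced : ∀ t → sumFin (suc l′) (λ i → baseSize i * coeff t i) ≡ 0ℚ
  coeff-balanced t = begin
    b₀ * (- bₛ) + sumFin l′ (λ t′ → baseSize (suc t′) * coeff t (suc t′))
      ≡⟨ cong (b₀ * (- bₛ) +_) (sumFin-single l′ _ t (λ t′ t′≢t →
           trans (cong (baseSize (suc t′) *_) (coeff-off t t′ t′≢t)) (*-zeroʳ (baseSize (suc t′))))) ⟩
    b₀ * (- bₛ) + bₛ * coeff t (suc t)
      ≡⟨ cong (λ q → b₀ * (- bₛ) + bₛ * q) (coeff-diag t) ⟩
    b₀ * (- bₛ) + bₛ * b₀
      ≡⟨ solve 2 (λ b₀ bₛ → b₀ :* (:- bₛ) :+ bₛ :* b₀ := con 0ℚ) refl b₀ bₛ ⟩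
    0ℚ ∎
    where bₛ = baseSize (suc t)

  eigenvector : Fin l′ → V → ℚ
  eigenvector t = blockV (coeff t)

  eigenvector-eigen : ∀ t → InEigenspace 1ℚ (eigenvector t)
  eigenvector-eigen t = blockV-eigenvector (coeff t) (coeff-balanced t)

  eigenvector-independent : LinIndep l′ eigenvector
  eigenvector-independent a combination≡0 t =
    *-cancelʳ-0 (a t) b₀ {{pos⇒nonZero b₀ {{baseSize-positive zero (nonempty zero)}}}}
                (trans (sym onBlock) (combination≡0 (inj₂ (suc t , fromℕ< (nonempty (suc t))))))
    where
    onBlock : sumFin l′ (λ t′ → a t′ * coeff t′ (suc t)) ≡ a t * b₀
    onBlock = trans (sumFin-single l′ _ t (λ t′ t′≢t → trans (cong (a t′ *_) (coeff-off t′ t (t′≢t ∘ sym)))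
                                                             (*-zeroʳ (a t′))))
                    (cong (a t *_) (coeff-diag t))

theorem4p5 : (l k : ℕ) → 0 < l → 0 < k →
    (G : Fin l → Graph) → (∀ i → 0 < n (G i)) →
    (φ : (i : Fin l) → KSymAut k (G i)) →
    (B : (i : Fin l) → Fin (n (G i)) → Bool) →
    (∀ i → IsBase (φ i) (B i)) →
    JoinLA.MultAtLeast k l G φ B 1ℚ (l ∸ 1)
theorem4p5 (suc l′) (suc k′) _ _ G nonempty φ B isBase =
  eigenvector , eigenvector-eigen , eigenvector-independent
  where open Eigenbasis l′ k′ G nonempty φ B isBase
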